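{- Let $s,t$ be positive integers and $m_i$ ($i<s$), $n_j$ ($j<t$) positive integers. Let $M_0, \ldots, M_{s-1}$ be linear orders each equal to $\omega$ or $\omega^*$ which alternate, and likewise $N_0, \ldots, N_{t-1}$, with $M_0 = \omega$ if and only if $N_0 = \omega^*$. Let $A = M_0^{m_0} \cdot M_1^{m_1} \cdots M_{s-1}^{m_{s-1}}$ and $B = N_0^{n_0} \cdot N_1^{n_1} \cdots N_{t-1}^{n_{t-1}}$. Then if $s = 1$ or $t = 1$ (or both), $l(A,B) = 1$, and otherwise $l(A,B) = 2$.
   Context: $\omega^*$ is the reverse of $\omega$. For linear orders $X, Y$, $X \cdot Y$ is the anti-lexicographic product ("$Y$ copies of $X$"): pairs $(x,y)$ compared first by $y$, then by $x$; $M^n$ is the product of $n$ copies of $M$. For $n \ge 1$, $X \equiv_n Y$ means player II has a winning strategy in the $n$-move Ehrenfeucht–Fraïssé game on $X$ and $Y$. $l(X,Y)$ is the non-zero natural number $n$ with $X \equiv_n Y$ and $X \not\equiv_{n+1} Y$. -}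

module Defs where

open import Data.Nat using (ℕ; zero; suc; _<_; _>_)
open import Data.Unit using (⊤; tt)
open import Data.Empty using (⊥)
open import Data.Product using (_×_; _,_; ∃)
open import Data.Sum using (_⊎_)
open import Data.List using (List; []; _∷_)
open import Data.List.Membership.Propositional using (_∈_)
open import Relation.Binary.PropositionalEquality using (_≡_)
open import Relation.Nullary using (¬_)
open import Function.Bundles using (_⇔_)

record LinOrd : Set₁ where
  field
    Carrier : Set
    _≺_     : Carrier → Carrier → Set
open LinOrd public

ωᴸ : LinOrd
ωᴸ = record { Carrier = ℕ ; _≺_ = _<_ }

ω*ᴸ : LinOrd
ω*ᴸ = record { Carrier = ℕ ; _≺_ = _>_ }

-- the one-point order (only used for degenerate exponent/length 0)
𝟙 : LinOrd
𝟙 = record { Carrier = ⊤ ; _≺_ = λ _ _ → ⊥ }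

-- anti-lexicographic product X · Y ("Y copies of X"):
-- (x , y) < (x' , y')  iff  y < y'  or  (y = y' and x < x')
_·_ : LinOrd → LinOrd → LinOrd
X · Y = record
  { Carrier = Carrier X × Carrier Y
  ; _≺_ = λ { (x , y) (x' , y') → _≺_ Y y y' ⊎ (y ≡ y' × _≺_ X x x') } }

infixl 7 _·_

_^ᴸ_ : LinOrd → ℕ → LinOrd
M ^ᴸ zero = 𝟙
M ^ᴸ suc zero = M
M ^ᴸ suc (suc n) = (M ^ᴸ suc n) · M

∏ᴸ : ℕ → (ℕ → LinOrd) → LinOrd
∏ᴸ zero F = 𝟙
∏ᴸ (suc zero) F = F 0
∏ᴸ (suc (suc k)) F = ∏ᴸ (suc k) F · F (suc k)

data Kind : Set where
  ω ω* : Kind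

⟦_⟧ : Kind → LinOrd
⟦ ω ⟧ = ωᴸ
⟦ ω* ⟧ = ω*ᴸ

-- Ehrenfeucht–Fraïssé games.
-- A position is the list of pairs of points chosen so far.
Position : LinOrd → LinOrd → Set
Position X Y = List (Carrier X × Carrier Y)

PartialIso : (X Y : LinOrd) → Position X Y → Set
PartialIso X Y p =
  ∀ {a b a' b'} → (a , b) ∈ p → (a' , b') ∈ p →
    ((a ≡ a') ⇔ (b ≡ b')) × (_≺_ X a a' ⇔ _≺_ Y b b')

-- IIWins X Y k p : player II has a winning strategy in the k-move game
-- starting from position p (I may play in either structure at each move).
IIWins : (X Y : LinOrd) → ℕ → Position X Y → Set
IIWins X Y zero p = PartialIso X Y p
IIWins X Y (suc k) p =
  (∀ (x : Carrier X) → ∃ λ (y : Carrier Y) → IIWins X Y k ((x , y) ∷ p)) ×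
  (∀ (y : Carrier Y) → ∃ λ (x : Carrier X) → IIWins X Y k ((x , y) ∷ p))

_≡[_]_ : LinOrd → ℕ → LinOrd → Set
X ≡[ n ] Y = IIWins X Y n []

l[_,_]≡_ : LinOrd → LinOrd → ℕ → Set
l[ X , Y ]≡ n = (X ≡[ n ] Y) × ¬ (X ≡[ suc n ] Y)

module Submission where

-- By symmetry of the game we may assume M₀ = ω, hence N₀ = ω*.
-- The value of l(A,B) is then decided by a few order-theoretic invariants:
--   * A has no maximum and a point without immediate predecessor (a limit point);
--     it has a minimum if s = 1 and no minimum if s ≥ 2;
--   * B has no minimum and every point of B has an immediate predecessor;
--     it has a maximum if t = 1 and no maximum if t ≥ 2.
-- These follow from the corresponding properties of ω and ω*, since right
-- multiplication preserves them (first factor) or creates them (second factor).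
-- On the game side, any two nonempty orders are ≡₁; two orders without endpoints
-- are ≡₂; a minimum (maximum) against no minimum (maximum) refutes ≡₂; and a limit
-- point against "every point has an immediate predecessor" refutes ≡₃.

open import Defs
open import Data.Nat using (ℕ; zero; suc; _<_; _≤_; s≤s; z≤n)
open import Data.Nat.Properties using (<-irrefl; <-trans; <-cmp; <⇒≱; m<1+n⇒m≤n; n<1+n)
open import Data.Product using (_×_; _,_; proj₁; proj₂; Σ; ∃; swap)
open import Data.Sum using (_⊎_; inj₁; inj₂) renaming (swap to ⊎-swap)
open import Data.Empty using (⊥-elim)
open import Data.Unit using (tt)
open import Data.List using (_∷_; []; map)
open import Data.List.Relation.Unary.Any using (here; there)
open import Data.List.Membership.Propositional using (_∈_)
open import Data.List.Membership.Propositional.Properties using (∈-map⁻)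
open import Relation.Binary using (tri<; tri≈; tri>)
open import Relation.Binary.PropositionalEquality using (_≡_; _≢_; refl)
open import Relation.Nullary using (¬_)
open import Function.Bundles using (_⇔_; mk⇔; Equivalence)
open import Function.Construct.Symmetry using (⇔-sym)

open Equivalence using (to; from)

-- A nonempty strict linear order: what player II needs to build strategies.
record IsLinear (X : LinOrd) : Set where
  field
    irrefl     : ∀ {a} → ¬ _≺_ X a a
    transitive : ∀ {a b c} → _≺_ X a b → _≺_ X b c → _≺_ X a c
    compare    : ∀ a b → _≺_ X a b ⊎ (a ≡ b ⊎ _≺_ X b a)
    point      : Carrier X
open IsLinear

linear-ω : IsLinear ωᴸ
linear-ω = record { irrefl = <-irrefl refl ; transitive = <-trans ; compare = compare-ℕ ; point = 0 }
  where
  compare-ℕ : ∀ a b → a < b ⊎ (a ≡ b ⊎ b < a)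
  compare-ℕ a b with <-cmp a b
  ... | tri< a<b _ _ = inj₁ a<b
  ... | tri≈ _ a≡b _ = inj₂ (inj₁ a≡b)
  ... | tri> _ _ b<a = inj₂ (inj₂ b<a)

linear-ω* : IsLinear ω*ᴸ
linear-ω* = record
  { irrefl = <-irrefl refl ; transitive = λ p q → <-trans q p ; compare = compare-ℕ ; point = 0 }
  where
  compare-ℕ : ∀ a b → b < a ⊎ (a ≡ b ⊎ a < b)
  compare-ℕ a b with <-cmp a b
  ... | tri< a<b _ _ = inj₂ (inj₂ a<b)
  ... | tri≈ _ a≡b _ = inj₂ (inj₁ a≡b)
  ... | tri> _ _ b<a = inj₁ b<a

linear-𝟙 : IsLinear 𝟙
linear-𝟙 = record
  { irrefl = λ () ; transitive = λ () ; compare = λ _ _ → inj₂ (inj₁ refl) ; point = tt }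

linear-· : ∀ {X Y} → IsLinear X → IsLinear Y → IsLinear (X · Y)
linear-· {X} {Y} linX linY = record
  { irrefl = irr ; transitive = trans≺ ; compare = cmp ; point = (point linX , point linY) }
  where
  irr : ∀ {a} → ¬ _≺_ (X · Y) a a
  irr (inj₁ y≺y) = irrefl linY y≺y
  irr (inj₂ (_ , x≺x)) = irrefl linX x≺x

  trans≺ : ∀ {a b c} → _≺_ (X · Y) a b → _≺_ (X · Y) b c → _≺_ (X · Y) a c
  trans≺ (inj₁ p) (inj₁ q) = inj₁ (transitive linY p q)
  trans≺ (inj₁ p) (inj₂ (refl , _)) = inj₁ p
  trans≺ (inj₂ (refl , _)) (inj₁ q) = inj₁ q
  trans≺ (inj₂ (refl , p)) (inj₂ (refl , q)) = inj₂ (refl , transitive linX p q)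

  cmp : ∀ a b → _≺_ (X · Y) a b ⊎ (a ≡ b ⊎ _≺_ (X · Y) b a)
  cmp (x , y) (x' , y') with compare linY y y'
  ... | inj₁ y≺y' = inj₁ (inj₁ y≺y')
  ... | inj₂ (inj₂ y'≺y) = inj₂ (inj₂ (inj₁ y'≺y))
  ... | inj₂ (inj₁ refl) with compare linX x x'
  ...   | inj₁ x≺x' = inj₁ (inj₂ (refl , x≺x'))
  ...   | inj₂ (inj₁ refl) = inj₂ (inj₁ refl)
  ...   | inj₂ (inj₂ x'≺x) = inj₂ (inj₂ (inj₂ (refl , x'≺x)))

pow-ind : (P : LinOrd → Set) (M : LinOrd) → (∀ X → P X → P (X · M)) → P M →
          ∀ m → 1 ≤ m → P (M ^ᴸ m)
pow-ind P M step base (suc zero) _ = base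
pow-ind P M step base (suc (suc m)) _ = step _ (pow-ind P M step base (suc m) (s≤s z≤n))

∏-ind : (P : LinOrd → Set) (F : ℕ → LinOrd) → (∀ X i → P X → P (X · F (suc i))) → P (F 0) →
        ∀ k → P (∏ᴸ (suc k) F)
∏-ind P F step base zero = base
∏-ind P F step base (suc k) = step _ k (∏-ind P F step base k)

∏-ind₂ : (P : LinOrd → Set) (F : ℕ → LinOrd) → (∀ X i → P X → P (X · F (suc i))) →
         (∀ X → P (X · F 1)) → ∀ k → P (∏ᴸ (suc (suc k)) F)
∏-ind₂ P F step base zero = base _
∏-ind₂ P F step base (suc k) = step _ (suc k) (∏-ind₂ P F step base k)

linear-pow : ∀ {M} → IsLinear M → ∀ m → IsLinear (M ^ᴸ m)
linear-pow linM zero = linear-𝟙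
linear-pow linM (suc m) = pow-ind IsLinear _ (λ _ linX → linear-· linX linM) linM (suc m) (s≤s z≤n)

linear-∏ : ∀ F → (∀ i → IsLinear (F i)) → ∀ k → IsLinear (∏ᴸ (suc k) F)
linear-∏ F linF = ∏-ind IsLinear F (λ _ i linX → linear-· linX (linF (suc i))) (linF 0)

HasMin HasMax NoMin NoMax : LinOrd → Set
HasMin X = Σ (Carrier X) λ a → ∀ b → ¬ _≺_ X b a
HasMax X = Σ (Carrier X) λ a → ∀ b → ¬ _≺_ X a b
NoMin X = ∀ a → Σ (Carrier X) λ b → _≺_ X b a
NoMax X = ∀ a → Σ (Carrier X) λ b → _≺_ X a b

-- Some point x₀ has no immediate predecessor: below x₀ there is always room.
HasLimitPoint : LinOrd → Set
HasLimitPoint X =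
  Σ (Carrier X) λ x₀ → ∀ a → _≺_ X a x₀ → Σ (Carrier X) λ z → _≺_ X a z × _≺_ X z x₀

EveryPointHasPred : LinOrd → Set
EveryPointHasPred X =
  ∀ b → Σ (Carrier X) λ b' → _≺_ X b' b × (∀ z → _≺_ X b' z → ¬ _≺_ X z b)

noMax-left : ∀ {X Y} → NoMax X → NoMax (X · Y)
noMax-left noMax (x , y) = (proj₁ (noMax x) , y) , inj₂ (refl , proj₂ (noMax x))

noMax-right : ∀ {X Y} → NoMax Y → NoMax (X · Y)
noMax-right noMax (x , y) = (x , proj₁ (noMax y)) , inj₁ (proj₂ (noMax y))

noMin-left : ∀ {X Y} → NoMin X → NoMin (X · Y)
noMin-left noMin (x , y) = (proj₁ (noMin x) , y) , inj₂ (refl , proj₂ (noMin x))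

noMin-right : ∀ {X Y} → NoMin Y → NoMin (X · Y)
noMin-right noMin (x , y) = (x , proj₁ (noMin y)) , inj₁ (proj₂ (noMin y))

min-· : ∀ {X Y} → HasMin X → HasMin Y → HasMin (X · Y)
min-· (a , a-min) (b , b-min) = (a , b) , λ
  { (c , d) (inj₁ d≺b) → b-min d d≺b
  ; (c , d) (inj₂ (_ , c≺a)) → a-min c c≺a }

max-· : ∀ {X Y} → HasMax X → HasMax Y → HasMax (X · Y)
max-· (a , a-max) (b , b-max) = (a , b) , λ
  { (c , d) (inj₁ b≺d) → b-max d b≺d
  ; (c , d) (inj₂ (_ , a≺c)) → a-max c a≺c }

pred-· : ∀ {X Y} → IsLinear Y → EveryPointHasPred X → EveryPointHasPred (X · Y)
pred-· {X} {Y} linY pred (x , y) =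
  let (x' , x'≺x , gap) = pred x
      no-room : ∀ z → _≺_ (X · Y) (x' , y) z → ¬ _≺_ (X · Y) z (x , y)
      no-room = λ
        { _ (inj₁ y≺z₂) (inj₁ z₂≺y) → irrefl linY (transitive linY y≺z₂ z₂≺y)
        ; _ (inj₁ y≺y) (inj₂ (refl , _)) → irrefl linY y≺y
        ; _ (inj₂ (refl , _)) (inj₁ y≺y) → irrefl linY y≺y
        ; (z₁ , _) (inj₂ (refl , x'≺z₁)) (inj₂ (_ , z₁≺x)) → gap z₁ x'≺z₁ z₁≺x }
  in (x' , y) , inj₂ (refl , x'≺x) , no-room

-- (x₀ , y) is a limit point of X · Y when x₀ is one of X: points of an earlier
-- copy are separated from it by their successors in X, points of the same copy
-- by the room below x₀.
limit-· : ∀ {X Y} → NoMax X → Carrier Y → HasLimitPoint X → HasLimitPoint (X · Y)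
limit-· {X} {Y} noMax y (x₀ , room) = (x₀ , y) , between
  where
  between : ∀ a → _≺_ (X · Y) a (x₀ , y) →
            Σ (Carrier (X · Y)) λ z → _≺_ (X · Y) a z × _≺_ (X · Y) z (x₀ , y)
  between (a₁ , a₂) (inj₁ a₂≺y) =
    (proj₁ (noMax a₁) , a₂) , inj₂ (refl , proj₂ (noMax a₁)) , inj₁ a₂≺y
  between (a₁ , _) (inj₂ (refl , a₁≺x₀)) =
    let (z , a₁≺z , z≺x₀) = room a₁ a₁≺x₀
    in (z , y) , inj₂ (refl , a₁≺z) , inj₂ (refl , z≺x₀)

noMax-limit-· : ∀ {X Y} → Carrier Y → NoMax X × HasLimitPoint X →
                NoMax (X · Y) × HasLimitPoint (X · Y)
noMax-limit-· y (noMax , limit) = noMax-left noMax , limit-· noMax y limit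

-- Every positive power of ω has a minimum, no maximum and a limit point (its
-- minimum); every positive power of ω* has a maximum, no minimum, and
-- immediate predecessors everywhere.
ω-power-min : ∀ m → 1 ≤ m → HasMin (ωᴸ ^ᴸ m)
ω-power-min = pow-ind HasMin ωᴸ (λ _ min → min-· min ω-min) ω-min
  where
  ω-min : HasMin ωᴸ
  ω-min = 0 , λ _ ()

ω-power-limit : ∀ m → 1 ≤ m → NoMax (ωᴸ ^ᴸ m) × HasLimitPoint (ωᴸ ^ᴸ m)
ω-power-limit = pow-ind (λ X → NoMax X × HasLimitPoint X) ωᴸ (λ _ → noMax-limit-· 0)
                  ((λ b → suc b , n<1+n b) , (0 , λ _ ()))

ω*-power-noMin : ∀ m → 1 ≤ m → NoMin (ω*ᴸ ^ᴸ m)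
ω*-power-noMin = pow-ind NoMin ω*ᴸ (λ _ → noMin-left) (λ b → suc b , n<1+n b)

ω*-power-pred : ∀ m → 1 ≤ m → EveryPointHasPred (ω*ᴸ ^ᴸ m)
ω*-power-pred = pow-ind EveryPointHasPred ω*ᴸ (λ _ → pred-· linear-ω*) pred
  where
  pred : EveryPointHasPred ω*ᴸ
  pred b = suc b , n<1+n b , λ z z<1+b b<z → <⇒≱ b<z (m<1+n⇒m≤n z<1+b)

ω*-power-max : ∀ m → 1 ≤ m → HasMax (ω*ᴸ ^ᴸ m)
ω*-power-max = pow-ind HasMax ω*ᴸ (λ _ max → max-· max ω*-max) ω*-max
  where
  ω*-max : HasMax ω*ᴸ
  ω*-max = 0 , λ _ ()

Agree : (X Y : LinOrd) → Carrier X × Carrier Y → Carrier X × Carrier Y → Set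
Agree X Y (x , y) (x' , y') = ((x ≡ x') ⇔ (y ≡ y')) × (_≺_ X x x' ⇔ _≺_ Y y y')

partialIso-2 : ∀ {X Y} {x y x' y'} → Agree X Y (x , y) (x , y) → Agree X Y (x' , y') (x' , y') →
               Agree X Y (x , y) (x' , y') → Agree X Y (x' , y') (x , y) →
               PartialIso X Y ((x , y) ∷ (x' , y') ∷ [])
partialIso-2 p _ _ _ (here refl) (here refl) = p
partialIso-2 _ _ q _ (here refl) (there (here refl)) = q
partialIso-2 _ _ _ r (there (here refl)) (here refl) = r
partialIso-2 _ s _ _ (there (here refl)) (there (here refl)) = s

module Strategies {X Y : LinOrd} (linX : IsLinear X) (linY : IsLinear Y) where

  agree-refl : ∀ x y → Agree X Y (x , y) (x , y)
  agree-refl x y = mk⇔ (λ _ → refl) (λ _ → refl) ,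
                   mk⇔ (λ x≺x → ⊥-elim (irrefl linX x≺x)) (λ y≺y → ⊥-elim (irrefl linY y≺y))

  agree-< : ∀ {x y x' y'} → _≺_ X x x' → _≺_ Y y y' → Agree X Y (x , y) (x' , y')
  agree-< x≺x' y≺y' =
    mk⇔ (λ { refl → ⊥-elim (irrefl linX x≺x') }) (λ { refl → ⊥-elim (irrefl linY y≺y') }) ,
    mk⇔ (λ _ → y≺y') (λ _ → x≺x')

  agree-> : ∀ {x y x' y'} → _≺_ X x' x → _≺_ Y y' y → Agree X Y (x , y) (x' , y')
  agree-> x'≺x y'≺y =
    mk⇔ (λ { refl → ⊥-elim (irrefl linX x'≺x) }) (λ { refl → ⊥-elim (irrefl linY y'≺y) }) ,
    mk⇔ (λ x≺x' → ⊥-elim (irrefl linX (transitive linX x≺x' x'≺x)))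
        (λ y≺y' → ⊥-elim (irrefl linY (transitive linY y≺y' y'≺y)))

  ≡₁-nonempty : X ≡[ 1 ] Y
  ≡₁-nonempty = (λ x → point linY , single x (point linY)) , (λ y → point linX , single (point linX) y)
    where
    single : ∀ x y → PartialIso X Y ((x , y) ∷ [])
    single x y (here refl) (here refl) = agree-refl x y

  same-side : ∀ {x y x' y'} → (_≺_ X x x' × _≺_ Y y y') ⊎ (x ≡ x' × y ≡ y') ⊎ (_≺_ X x' x × _≺_ Y y' y) →
              PartialIso X Y ((x , y) ∷ (x' , y') ∷ [])
  same-side {x} {y} {x'} {y'} (inj₁ (x≺x' , y≺y')) =
    partialIso-2 (agree-refl x y) (agree-refl x' y') (agree-< x≺x' y≺y') (agree-> x≺x' y≺y')
  same-side {x} {y} (inj₂ (inj₁ (refl , refl))) =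
    partialIso-2 (agree-refl x y) (agree-refl x y) (agree-refl x y) (agree-refl x y)
  same-side {x} {y} {x'} {y'} (inj₂ (inj₂ (x'≺x , y'≺y))) =
    partialIso-2 (agree-refl x y) (agree-refl x' y') (agree-> x'≺x y'≺y) (agree-< x'≺x y'≺y)

  -- In orders without endpoints, II answers the second move on the same side of
  -- the first pair as I's move.
  second-move : NoMin X → NoMax X → NoMin Y → NoMax Y → ∀ x y → IIWins X Y 1 ((x , y) ∷ [])
  second-move noMinX noMaxX noMinY noMaxY x y = answer-in-Y , answer-in-X
    where
    answer-in-Y : ∀ x' → ∃ λ y' → PartialIso X Y ((x' , y') ∷ (x , y) ∷ [])
    answer-in-Y x' with compare linX x' x
    ... | inj₁ x'≺x = proj₁ (noMinY y) , same-side (inj₁ (x'≺x , proj₂ (noMinY y)))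
    ... | inj₂ (inj₁ refl) = y , same-side (inj₂ (inj₁ (refl , refl)))
    ... | inj₂ (inj₂ x≺x') = proj₁ (noMaxY y) , same-side (inj₂ (inj₂ (x≺x' , proj₂ (noMaxY y))))

    answer-in-X : ∀ y' → ∃ λ x' → PartialIso X Y ((x' , y') ∷ (x , y) ∷ [])
    answer-in-X y' with compare linY y' y
    ... | inj₁ y'≺y = proj₁ (noMinX x) , same-side (inj₁ (proj₂ (noMinX x) , y'≺y))
    ... | inj₂ (inj₁ refl) = x , same-side (inj₂ (inj₁ (refl , refl)))
    ... | inj₂ (inj₂ y≺y') = proj₁ (noMaxX x) , same-side (inj₂ (inj₂ (proj₂ (noMaxX x) , y≺y')))

  ≡₂-noEndpoints : NoMin X → NoMax X → NoMin Y → NoMax Y → X ≡[ 2 ] Y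
  ≡₂-noEndpoints noMinX noMaxX noMinY noMaxY =
    (λ x → point linY , second-move noMinX noMaxX noMinY noMaxY x (point linY)) ,
    (λ y → point linX , second-move noMinX noMaxX noMinY noMaxY (point linX) y)

order-agrees : ∀ {X Y p a b a' b'} → PartialIso X Y p → (a , b) ∈ p → (a' , b') ∈ p →
               _≺_ X a a' ⇔ _≺_ Y b b'
order-agrees iso i j = proj₂ (iso i j)

-- A position from which II can still win is already a partial isomorphism:
-- let I replay the point x₀ and restrict the resulting final position.
wins⇒partialIso : ∀ {X Y} → Carrier X → ∀ k {p} → IIWins X Y k p → PartialIso X Y p
wins⇒partialIso x₀ zero iso = iso
wins⇒partialIso x₀ (suc k) w i j =
  wins⇒partialIso x₀ k (proj₂ (proj₁ w x₀)) (there i) (there j)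

-- I plays the minimum a of X, then a point of Y below II's answer; II has no reply below a.
min-vs-noMin : ∀ {X Y} → HasMin X → NoMin Y → ¬ X ≡[ 2 ] Y
min-vs-noMin (a , a-min) noMin w =
  let (y , w₁) = proj₁ w a
      (y' , y'≺y) = noMin y
      (x , iso) = proj₂ w₁ y'
  in a-min x (from (order-agrees iso (here refl) (there (here refl))) y'≺y)

-- Dually: I plays the maximum b of Y, then a point of X above II's answer.
noMax-vs-max : ∀ {X Y} → NoMax X → HasMax Y → ¬ X ≡[ 2 ] Y
noMax-vs-max noMax (b , b-max) w =
  let (x , w₁) = proj₂ w b
      (x' , x≺x') = noMax x
      (y , iso) = proj₁ w₁ x'
  in b-max y (to (order-agrees iso (there (here refl)) (here refl)) x≺x')

-- I plays a limit point x₀ of X, then the immediate predecessor y' of II's answer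
-- y; II must answer some a ≺ x₀, and I plays a point of X strictly between a and
-- x₀, for which there is no counterpart strictly between y' and y.
limit-vs-pred : ∀ {X Y} → HasLimitPoint X → EveryPointHasPred Y → ¬ X ≡[ 3 ] Y
limit-vs-pred (x₀ , room) pred w =
  let (y , w₂) = proj₁ w x₀
      (y' , y'≺y , gap) = pred y
      (a , w₁) = proj₂ w₂ y'
      a≺x₀ = from (order-agrees (wins⇒partialIso x₀ 1 w₁) (here refl) (there (here refl))) y'≺y
      (z , a≺z , z≺x₀) = room a a≺x₀
      (v , iso) = proj₁ w₁ z
  in gap v (to (order-agrees iso (there (here refl)) (here refl)) a≺z)
           (to (order-agrees iso (here refl) (there (there (here refl)))) z≺x₀)

partialIso-swap : ∀ {X Y p} → PartialIso X Y p → PartialIso Y X (map swap p)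
partialIso-swap iso i j with ∈-map⁻ swap i | ∈-map⁻ swap j
... | (_ , i' , refl) | (_ , j' , refl) = ⇔-sym (proj₁ (iso i' j')) , ⇔-sym (proj₂ (iso i' j'))

wins-swap : ∀ {X Y} k {p} → IIWins X Y k p → IIWins Y X k (map swap p)
wins-swap zero iso = partialIso-swap iso
wins-swap (suc k) (forth , back) =
  (λ y → let (x , w) = back y in x , wins-swap k w) ,
  (λ x → let (y , w) = forth x in y , wins-swap k w)

l-swap : ∀ {X Y n} → l[ X , Y ]≡ n → l[ Y , X ]≡ n
l-swap {n = n} (equiv , inequiv) = wins-swap n equiv , λ w → inequiv (wins-swap (suc n) w)

-- Invariants of a product of s blocks starting with an ω-block.
record ωLed (s : ℕ) (A : LinOrd) : Set where
  field
    linear       : IsLinear A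
    noMax        : NoMax A
    limit        : HasLimitPoint A
    min-if-one   : s ≡ 1 → HasMin A
    noMin-if-two : 1 < s → NoMin A

record ω*Led (t : ℕ) (B : LinOrd) : Set where
  field
    linear       : IsLinear B
    noMin        : NoMin B
    pred         : EveryPointHasPred B
    max-if-one   : t ≡ 1 → HasMax B
    noMax-if-two : 1 < t → NoMax B

Verdict : ℕ → ℕ → LinOrd → LinOrd → Set
Verdict s t A B = ((s ≡ 1 ⊎ t ≡ 1) → l[ A , B ]≡ 1) × (¬ (s ≡ 1 ⊎ t ≡ 1) → l[ A , B ]≡ 2)

verdict-swap : ∀ {s t A B} → Verdict t s B A → Verdict s t A B
verdict-swap (one , two) = (λ h → l-swap (one (⊎-swap h))) , (λ h → l-swap (two (λ h' → h (⊎-swap h'))))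

verdict : ∀ s t {A B} → 1 ≤ s → 1 ≤ t → ωLed s A → ω*Led t B → Verdict s t A B
verdict (suc zero) t _ _ a b =
  (λ _ → ≡₁-nonempty , min-vs-noMin (ωLed.min-if-one a refl) (ω*Led.noMin b)) ,
  (λ not-one → ⊥-elim (not-one (inj₁ refl)))
  where open Strategies (ωLed.linear a) (ω*Led.linear b)
verdict (suc (suc s)) (suc zero) _ _ a b =
  (λ _ → ≡₁-nonempty , noMax-vs-max (ωLed.noMax a) (ω*Led.max-if-one b refl)) ,
  (λ not-one → ⊥-elim (not-one (inj₂ refl)))
  where open Strategies (ωLed.linear a) (ω*Led.linear b)
verdict (suc (suc s)) (suc (suc t)) _ _ a b =
  (λ { (inj₁ ()) ; (inj₂ ()) }) ,
  (λ _ → ≡₂-noEndpoints (ωLed.noMin-if-two a two) (ωLed.noMax a)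
                        (ω*Led.noMin b) (ω*Led.noMax-if-two b two) ,
         limit-vs-pred (ωLed.limit a) (ω*Led.pred b))
  where
  open Strategies (ωLed.linear a) (ω*Led.linear b)
  two : ∀ {k} → 1 < suc (suc k)
  two = s≤s (s≤s z≤n)

ωLed-∏ : ∀ k F → (∀ i → IsLinear (F i)) → HasMin (F 0) → NoMax (F 0) × HasLimitPoint (F 0) →
         (0 < k → NoMin (F 1)) → ωLed (suc k) (∏ᴸ (suc k) F)
ωLed-∏ k F linF min noMax-limit noMin₁ = record
  { linear = linear-∏ F linF k
  ; noMax = proj₁ noMax-limit-∏
  ; limit = proj₂ noMax-limit-∏
  ; min-if-one = min-∏ k
  ; noMin-if-two = noMin-∏ k noMin₁ }
  where
  noMax-limit-∏ : NoMax (∏ᴸ (suc k) F) × HasLimitPoint (∏ᴸ (suc k) F)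
  noMax-limit-∏ = ∏-ind (λ X → NoMax X × HasLimitPoint X) F
                        (λ _ i → noMax-limit-· (point (linF (suc i)))) noMax-limit k
  min-∏ : ∀ k → suc k ≡ 1 → HasMin (∏ᴸ (suc k) F)
  min-∏ zero _ = min
  min-∏ (suc k) ()
  noMin-∏ : ∀ k → (0 < k → NoMin (F 1)) → 1 < suc k → NoMin (∏ᴸ (suc k) F)
  noMin-∏ zero _ (s≤s ())
  noMin-∏ (suc k) noMin₁ _ =
    ∏-ind₂ NoMin F (λ _ _ → noMin-left) (λ _ → noMin-right (noMin₁ (s≤s z≤n))) k

ω*Led-∏ : ∀ k F → (∀ i → IsLinear (F i)) → HasMax (F 0) → NoMin (F 0) → EveryPointHasPred (F 0) →
          (0 < k → NoMax (F 1)) → ω*Led (suc k) (∏ᴸ (suc k) F)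
ω*Led-∏ k F linF max noMin pred noMax₁ = record
  { linear = linear-∏ F linF k
  ; noMin = ∏-ind NoMin F (λ _ _ → noMin-left) noMin k
  ; pred = ∏-ind EveryPointHasPred F (λ _ i → pred-· (linF (suc i))) pred k
  ; max-if-one = max-∏ k
  ; noMax-if-two = noMax-∏ k noMax₁ }
  where
  max-∏ : ∀ k → suc k ≡ 1 → HasMax (∏ᴸ (suc k) F)
  max-∏ zero _ = max
  max-∏ (suc k) ()
  noMax-∏ : ∀ k → (0 < k → NoMax (F 1)) → 1 < suc k → NoMax (∏ᴸ (suc k) F)
  noMax-∏ zero _ (s≤s ())
  noMax-∏ (suc k) noMax₁ _ =
    ∏-ind₂ NoMax F (λ _ _ → noMax-left) (λ _ → noMax-right (noMax₁ (s≤s z≤n))) k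

block : (ℕ → Kind) → (ℕ → ℕ) → ℕ → LinOrd
block M m i = ⟦ M i ⟧ ^ᴸ m i

linear-block : ∀ M m i → IsLinear (block M m i)
linear-block M m i = linear-pow (linear-kind (M i)) (m i)
  where
  linear-kind : ∀ K → IsLinear ⟦ K ⟧
  linear-kind ω = linear-ω
  linear-kind ω* = linear-ω*

block-fact : (P : LinOrd → Set) (K : Kind) → (∀ m → 1 ≤ m → P (⟦ K ⟧ ^ᴸ m)) →
             ∀ M m i → M i ≡ K → 1 ≤ m i → P (block M m i)
block-fact P K fact M m i refl = fact (m i)

opposite : Kind → Kind
opposite ω = ω*
opposite ω* = ω

next-kind : ∀ {a b} K → a ≡ K → a ≢ b → b ≡ opposite K
next-kind {b = ω} ω refl ω≢ω = ⊥-elim (ω≢ω refl)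
next-kind {b = ω*} ω refl _ = refl
next-kind {b = ω} ω* refl _ = refl
next-kind {b = ω*} ω* refl ω*≢ω* = ⊥-elim (ω*≢ω* refl)

Led : Kind → ℕ → LinOrd → Set
Led ω = ωLed
Led ω* = ω*Led

led-blocks : ∀ k M m → (∀ i → i < suc k → 1 ≤ m i) → (∀ i → suc i < suc k → M i ≢ M (suc i)) →
             Led (M 0) (suc k) (∏ᴸ (suc k) (block M m))
led-blocks k M m pos alt with M 0 in M₀≡
... | ω = ωLed-∏ k (block M m) (linear-block M m)
            (block-fact HasMin ω ω-power-min M m 0 M₀≡ (pos 0 (s≤s z≤n)))
            (block-fact (λ X → NoMax X × HasLimitPoint X) ω ω-power-limit M m 0 M₀≡ (pos 0 (s≤s z≤n)))
            (λ 0<k → block-fact NoMin ω* ω*-power-noMin M m 1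
                       (next-kind ω M₀≡ (alt 0 (s≤s 0<k))) (pos 1 (s≤s 0<k)))
... | ω* = ω*Led-∏ k (block M m) (linear-block M m)
             (block-fact HasMax ω* ω*-power-max M m 0 M₀≡ (pos 0 (s≤s z≤n)))
             (block-fact NoMin ω* ω*-power-noMin M m 0 M₀≡ (pos 0 (s≤s z≤n)))
             (block-fact EveryPointHasPred ω* ω*-power-pred M m 0 M₀≡ (pos 0 (s≤s z≤n)))
             (λ 0<k → block-fact NoMax ω (λ m pos → proj₁ (ω-power-limit m pos)) M m 1
                        (next-kind ω* M₀≡ (alt 0 (s≤s 0<k))) (pos 1 (s≤s 0<k)))

first-kinds-opposite : ∀ {a b} → ((a ≡ ω) ⇔ (b ≡ ω*)) → b ≡ opposite a
first-kinds-opposite {ω} iff = to iff refl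
first-kinds-opposite {ω*} {ω} iff = refl
first-kinds-opposite {ω*} {ω*} iff with from iff refl
... | ()

theorem3p1 : (s t : ℕ) → 1 ≤ s → 1 ≤ t →
    (m n : ℕ → ℕ) →
    (∀ i → i < s → 1 ≤ m i) → (∀ j → j < t → 1 ≤ n j) →
    (M N : ℕ → Kind) →
    (∀ i → suc i < s → M i ≢ M (suc i)) →
    (∀ j → suc j < t → N j ≢ N (suc j)) →
    ((M 0 ≡ ω) ⇔ (N 0 ≡ ω*)) →
    let A = ∏ᴸ s (λ i → ⟦ M i ⟧ ^ᴸ m i)
        B = ∏ᴸ t (λ j → ⟦ N j ⟧ ^ᴸ n j)
    in ((s ≡ 1 ⊎ t ≡ 1) → l[ A , B ]≡ 1) ×
       (¬ (s ≡ 1 ⊎ t ≡ 1) → l[ A , B ]≡ 2)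
theorem3p1 (suc s) (suc t) 1≤s 1≤t m n m-pos n-pos M N M-alt N-alt first-kinds
  with M 0 | N 0 | first-kinds-opposite first-kinds
     | led-blocks s M m m-pos M-alt | led-blocks t N n n-pos N-alt
... | ω | .ω* | refl | A-led | B-led = verdict (suc s) (suc t) 1≤s 1≤t A-led B-led
... | ω* | .ω | refl | A-led | B-led = verdict-swap (verdict (suc t) (suc s) 1≤t 1≤s B-led A-led)
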